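{- Let $n$ be a positive integer, let $T\subset\mathbb{Q}\cup\{\infty\}$ be a finite set such that $t\in T$ implies $1/t\in T$, and let $\mathscr{M}$ be a solvable $n\times n$ RK puzzle with slope set $T$. If the $(i,j)$-entry of $\mathscr{M}$ is uniquely solvable, then the $(j,i)$-entry and the $(n-j+1,n-i+1)$-entry of $\mathscr{M}$ are also uniquely solvable.
   Context: Conventions: $1/0=\infty$ and $1/\infty=0$. For a positive integer $n$ let $I_n=\{1,\dots,n\}$, and let $I_{n,m}=I_n\times I_m\subset\mathbb{R}^2$, viewed as lattice points in the Cartesian plane. For a slope $s\in\mathbb{Q}\cup\{\infty\}$ let $\mathscr{L}_s$ be the set of lines $\ell\subset\mathbb{R}^2$ of slope $s$ with $\ell\cap I_{n,m}\neq\emptyset$. For $\ell\in\mathscr{L}_s$ the clue polynomial is $P_{\ell,s}(X)=\sum_{(i,j)\in\ell\cap I_{n,m}}X_{i,j}$ in the $nm$ variables $X_{i,j}$. An $n\times m$ RK puzzle with (finite) slope set $T$ is a system of linear equations consisting of one equation $P_{\ell,t}(X)=c_{\ell,t}$, with arbitrary $c_{\ell,t}\in\mathbb{R}$, for every $t\in T$ and every $\ell\in\mathscr{L}_t$. A solution is a real solution of this system; the puzzle is solvable if it has a solution. The $(i,j)$-entry is the variable $X_{i,j}$; it is uniquely solvable if all solutions of the puzzle have the same value of $X_{i,j}$. -}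

module Defs where

open import Level using (Level; _⊔_) renaming (suc to lsuc)
open import Algebra.Bundles using (CommutativeRing)
open import Data.Nat as ℕ using (ℕ; suc)
open import Data.Fin using (Fin; toℕ)
open import Data.Fin.Base using (opposite)
open import Data.List using (List; []; _∷_; foldr; concatMap; map; filter)
open import Data.List.Base using (allFin)
open import Data.List.Membership.Propositional using (_∈_)
open import Data.Maybe using (Maybe; just; nothing)
open import Data.Product using (Σ; _×_; _,_; proj₁; proj₂)
open import Data.Integer using (+_)
open import Data.Rational as ℚ using (ℚ; 0ℚ; _≟_)
open import Relation.Nullary using (¬_)
open import Relation.Binary.PropositionalEquality using (_≡_)

record Field (c ℓ : Level) : Set (lsuc (c ⊔ ℓ)) where
  field
    commutativeRing : CommutativeRing c ℓ
  open CommutativeRing commutativeRing public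
  field
    0≉1     : ¬ (0# ≈ 1#)
    inverse : ∀ x → ¬ (x ≈ 0#) → Σ Carrier λ y → (x * y) ≈ 1#

-- Slopes: ℚ ∪ {∞}; nothing represents ∞.
Slope : Set
Slope = Maybe ℚ

-- 1/t with the conventions 1/0 = ∞ and 1/∞ = 0.
inv : Slope → Slope
inv nothing = just 0ℚ
inv (just s) with s ≟ 0ℚ
... | Relation.Nullary.yes _ = nothing
... | Relation.Nullary.no s≢0 = just (ℚ.1/_ s {{ℚ.≢-nonZero s≢0}})

-- Lattice coordinate (1-based) of a Fin index.
coord : ∀ {n} → Fin n → ℚ
coord a = ℚ._/_ (+ suc (toℕ a)) 1

-- A line of slope t is identified by its "intercept" key:
--   slope s ∈ ℚ : the line { (x,y) | y - s·x = k },
--   slope ∞     : the line { (x,y) | x = k }.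
-- Two lattice points lie on the same line of slope t iff their keys agree.
key : ∀ {n} → Slope → Fin n → Fin n → ℚ
key nothing  a b = coord a
key (just s) a b = coord b ℚ.- (s ℚ.* coord a)

-- All lattice points of I_{n,n}, as index pairs (a , b) standing for (a+1 , b+1).
points : ∀ n → List (Fin n × Fin n)
points n = concatMap (λ a → map (λ b → (a , b)) (allFin n)) (allFin n)

-- An n×n RK puzzle over the field F: a finite slope set T and constants,
-- one constant per (slope, line), the line being given by its key.
record RKPuzzle {c ℓ} (F : Field c ℓ) (n : ℕ) : Set c where
  field
    slopes : List Slope
    clue   : Slope → ℚ → Field.Carrier F

module _ {c ℓ} (F : Field c ℓ) {n : ℕ} where
  open Field F

  Assignment : Set c
  Assignment = Fin n → Fin n → Carrier

  sumList : List Carrier → Carrier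
  sumList = foldr _+_ 0#

  cluePoly : Slope → ℚ → Assignment → Carrier
  cluePoly t k X =
    sumList (map (λ p → X (proj₁ p) (proj₂ p))
                 (filter (λ p → key t (proj₁ p) (proj₂ p) ≟ k) (points n)))

  -- X is a solution: every equation P_{ℓ,t}(X) = c_{ℓ,t} holds, for every
  -- t ∈ T and every line ℓ of slope t meeting I_{n,n} (each such line is the
  -- line of slope t through some lattice point (a , b)).
  IsSolution : RKPuzzle F n → Assignment → Set ℓ
  IsSolution M X = ∀ t → t ∈ RKPuzzle.slopes M → ∀ (a b : Fin n) →
    cluePoly t (key t a b) X ≈ RKPuzzle.clue M t (key t a b)

  Solvable : RKPuzzle F n → Set (c ⊔ ℓ)
  Solvable M = Σ Assignment (IsSolution M)

  UniquelySolvable : RKPuzzle F n → Fin n → Fin n → Set (c ⊔ ℓ)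
  UniquelySolvable M a b =
    ∀ X Y → IsSolution M X → IsSolution M Y → X a b ≈ Y a b

-- Transposition (a , b) ↦ (b , a) and antitransposition (a , b) ↦ (n+1−b , n+1−a)
-- permute the grid and carry each line of slope t onto a line of slope 1/t, changing
-- its key by an injective affine map.  When T is closed under t ↦ 1/t they therefore
-- map homogeneous solutions (all clues 0) to homogeneous solutions.  For a solvable
-- puzzle the (i , j)-entry is uniquely solvable exactly when every homogeneous
-- solution vanishes there, so unique solvability is transported along both symmetries.
module Submission where

open import Defs
open import Level using (Level; _⊔_)
open import Data.Nat using (ℕ; _≤_)
open import Data.Fin using (Fin; opposite)
open import Data.Product using (_×_)
open import Data.List.Membership.Propositional using (_∈_)

import Data.Nat as ℕ
import Data.Nat.Properties as ℕₚ
open import Data.Fin using (toℕ; zero; suc)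
open import Data.Fin.Properties using (opposite-prop; toℕ<n)
import Data.Fin.Permutation as Perm
open import Data.Product using (_,_; uncurry)
open import Data.Maybe using (just; nothing)
open import Data.Bool using (true; false; if_then_else_)
open import Data.List using (List; allFin; []; _∷_; map; foldr; filter; tabulate; concatMap; _++_)
open import Data.List.Properties using (map-∘)
open import Function using (_∘_)
open import Algebra.Bundles using (AbelianGroup)
open import Data.Integer as ℤ using (+_)
import Data.Integer.Properties as ℤₚ
open import Data.Rational as ℚ using (ℚ; 0ℚ; 1ℚ; _≟_)
import Data.Rational.Properties as ℚₚ
import Data.Rational.Unnormalised as ℚᵘ
import Data.Rational.Unnormalised.Properties as ℚᵘₚ
open import Data.Rational.Solver using (module +-*-Solver)
open import Function.Definitions using (Injective)
open import Relation.Nullary using (Dec; does; yes; no)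
open import Relation.Nullary.Decidable using (does-⇔)
open import Function.Bundles using (mk⇔)
open import Relation.Binary.PropositionalEquality as ≡ using (_≡_; refl; cong; cong₂; module ≡-Reasoning)

open +-*-Solver

Point : ℕ → Set
Point n = Fin n × Fin n

keyOf : ∀ {n} → Slope → Point n → ℚ
keyOf t = uncurry (key t)

ℕ/1-homo-+ : ∀ m k → + (m ℕ.+ k) ℚ./ 1 ≡ + m ℚ./ 1 ℚ.+ + k ℚ./ 1
ℕ/1-homo-+ m k = ℚₚ.toℚᵘ-injective (begin
  ℚ.toℚᵘ (+ (m ℕ.+ k) ℚ./ 1)                   ≈⟨ ℚₚ.toℚᵘ-fromℚᵘ (ℚᵘ.mkℚᵘ (+ (m ℕ.+ k)) 0) ⟩
  ℚᵘ.mkℚᵘ (+ (m ℕ.+ k)) 0                       ≈⟨ ℚᵘ.*≡* numerators ⟩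
  ℚᵘ.mkℚᵘ (+ m) 0 ℚᵘ.+ ℚᵘ.mkℚᵘ (+ k) 0          ≈⟨ ℚᵘₚ.+-cong (ℚᵘₚ.≃-sym (ℚₚ.toℚᵘ-fromℚᵘ (ℚᵘ.mkℚᵘ (+ m) 0)))
                                                    (ℚᵘₚ.≃-sym (ℚₚ.toℚᵘ-fromℚᵘ (ℚᵘ.mkℚᵘ (+ k) 0))) ⟩
  ℚ.toℚᵘ (+ m ℚ./ 1) ℚᵘ.+ ℚ.toℚᵘ (+ k ℚ./ 1)  ≈⟨ ℚᵘₚ.≃-sym (ℚₚ.toℚᵘ-homo-+ (+ m ℚ./ 1) (+ k ℚ./ 1)) ⟩
  ℚ.toℚᵘ (+ m ℚ./ 1 ℚ.+ + k ℚ./ 1)             ∎)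
  where
  open ℚᵘₚ.≃-Reasoning
  numerators : + (m ℕ.+ k) ℤ.* + 1 ≡ (+ m ℤ.* + 1 ℤ.+ + k ℤ.* + 1) ℤ.* + 1
  numerators = ≡.trans (ℤₚ.*-identityʳ _) (≡.trans (ℤₚ.pos-+ m k) (≡.sym
    (≡.trans (ℤₚ.*-identityʳ _) (cong₂ ℤ._+_ (ℤₚ.*-identityʳ (+ m)) (ℤₚ.*-identityʳ (+ k))))))

coord-opposite : ∀ {n} (a : Fin n) → coord (opposite a) ≡ + ℕ.suc n ℚ./ 1 ℚ.- coord a
coord-opposite {n} a = begin
  coord (opposite a)                              ≡⟨ solve 2 (λ x y → x := (x :+ y) :- y) refl (coord (opposite a)) (coord a) ⟩
  (coord (opposite a) ℚ.+ coord a) ℚ.- coord a    ≡⟨ cong (ℚ._- coord a) (ℕ/1-homo-+ (ℕ.suc (toℕ (opposite a))) (ℕ.suc (toℕ a))) ⟨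
  + (ℕ.suc (toℕ (opposite a)) ℕ.+ ℕ.suc (toℕ a)) ℚ./ 1 ℚ.- coord a
                                                  ≡⟨ cong (λ m → + m ℚ./ 1 ℚ.- coord a) coordinates-sum ⟩
  + ℕ.suc n ℚ./ 1 ℚ.- coord a                     ∎
  where
  open ≡-Reasoning
  coordinates-sum : ℕ.suc (toℕ (opposite a)) ℕ.+ ℕ.suc (toℕ a) ≡ ℕ.suc n
  coordinates-sum = cong ℕ.suc (≡.trans (cong (ℕ._+ ℕ.suc (toℕ a)) (opposite-prop a)) (ℕₚ.m∸n+n≡m (toℕ<n a)))

affine-injective : ∀ {α⁻¹} α β → α⁻¹ ℚ.* α ≡ 1ℚ → Injective _≡_ _≡_ (λ z → α ℚ.* z ℚ.+ β)
affine-injective {α⁻¹} α β α⁻¹*α≡1 {z} {w} αz+β≡αw+β = begin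
  z                                    ≡⟨ unscale z ⟨
  α⁻¹ ℚ.* ((α ℚ.* z ℚ.+ β) ℚ.- β)      ≡⟨ cong (λ u → α⁻¹ ℚ.* (u ℚ.- β)) αz+β≡αw+β ⟩
  α⁻¹ ℚ.* ((α ℚ.* w ℚ.+ β) ℚ.- β)      ≡⟨ unscale w ⟩
  w                                    ∎
  where
  open ≡-Reasoning
  unscale : ∀ x → α⁻¹ ℚ.* ((α ℚ.* x ℚ.+ β) ℚ.- β) ≡ x
  unscale x = begin
    α⁻¹ ℚ.* ((α ℚ.* x ℚ.+ β) ℚ.- β)  ≡⟨ solve 4 (λ a' a b x → a' :* ((a :* x :+ b) :- b) := (a' :* a) :* x) refl α⁻¹ α β x ⟩
    (α⁻¹ ℚ.* α) ℚ.* x                ≡⟨ cong (ℚ._* x) α⁻¹*α≡1 ⟩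
    1ℚ ℚ.* x                         ≡⟨ ℚₚ.*-identityˡ x ⟩
    x                                ∎

-- The ring solver cannot use s · (1/s) = 1, so identities involving 1/s are solved
-- with the defect (e − 1) · y left explicit and then cancelled here.
x+[e-1]y≡x : ∀ {e} x y → e ≡ 1ℚ → x ℚ.+ (e ℚ.- 1ℚ) ℚ.* y ≡ x
x+[e-1]y≡x x y refl = solve 2 (λ x y → x :+ (con 1ℚ :- con 1ℚ) :* y := x) refl x y

record MapsLines {n} (σ : Point n → Point n) (t t′ : Slope) : Set where
  field
    scale scale⁻¹ offset : ℚ
    scale⁻¹*scale : scale⁻¹ ℚ.* scale ≡ 1ℚ
    key-σ : ∀ p → keyOf t′ (σ p) ≡ scale ℚ.* keyOf t p ℚ.+ offset

  same-line : ∀ p q → does (keyOf t p ≟ keyOf t q) ≡ does (keyOf t′ (σ p) ≟ keyOf t′ (σ q))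
  same-line p q rewrite key-σ p | key-σ q =
    does-⇔ (mk⇔ (cong rescale) (affine-injective {scale⁻¹} scale offset scale⁻¹*scale))
           (keyOf t p ≟ keyOf t q) (rescale _ ≟ rescale _)
    where
    rescale : ℚ → ℚ
    rescale z = scale ℚ.* z ℚ.+ offset

transpose : ∀ {n} → Point n → Point n
transpose (a , b) = b , a

antitranspose : ∀ {n} → Point n → Point n
antitranspose (a , b) = opposite b , opposite a

transpose-mapsLines : ∀ {n} t → MapsLines {n} transpose t (inv t)
transpose-mapsLines nothing = record
  { scale = 1ℚ ; scale⁻¹ = 1ℚ ; offset = 0ℚ ; scale⁻¹*scale = refl
  ; key-σ = λ (a , b) → solve 2 (λ x y → x :- con 0ℚ :* y := con 1ℚ :* x :+ con 0ℚ) refl (coord a) (coord b) }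
transpose-mapsLines (just s) with s ≟ 0ℚ
... | yes refl = record
  { scale = 1ℚ ; scale⁻¹ = 1ℚ ; offset = 0ℚ ; scale⁻¹*scale = refl
  ; key-σ = λ (a , b) → solve 2 (λ x y → y := con 1ℚ :* (y :- con 0ℚ :* x) :+ con 0ℚ) refl (coord a) (coord b) }
... | no s≢0 = record
  { scale = ℚ.- r ; scale⁻¹ = ℚ.- s ; offset = 0ℚ
  ; scale⁻¹*scale = ≡.trans (solve 2 (λ s r → (:- s) :* (:- r) := s :* r) refl s r) (ℚₚ.*-inverseʳ s)
  ; key-σ = key-σ }
  where
  instance _ = ℚ.≢-nonZero s≢0
  r = ℚ.1/ s
  key-σ : ∀ p → keyOf (just r) (transpose p) ≡ (ℚ.- r) ℚ.* keyOf (just s) p ℚ.+ 0ℚ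
  key-σ (a , b) = begin
    coord a ℚ.- r ℚ.* coord b
      ≡⟨ solve 4 (λ x y r s → x :- r :* y := ((:- r) :* (y :- s :* x) :+ con 0ℚ) :+ (r :* s :- con 1ℚ) :* (:- x))
               refl (coord a) (coord b) r s ⟩
    ((ℚ.- r) ℚ.* (coord b ℚ.- s ℚ.* coord a) ℚ.+ 0ℚ) ℚ.+ (r ℚ.* s ℚ.- 1ℚ) ℚ.* (ℚ.- coord a)
      ≡⟨ x+[e-1]y≡x _ _ (ℚₚ.*-inverseˡ s) ⟩
    (ℚ.- r) ℚ.* (coord b ℚ.- s ℚ.* coord a) ℚ.+ 0ℚ
      ∎
    where open ≡-Reasoning

antitranspose-mapsLines : ∀ {n} t → MapsLines {n} antitranspose t (inv t)
antitranspose-mapsLines {n} nothing = record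
  { scale = ℚ.- 1ℚ ; scale⁻¹ = ℚ.- 1ℚ ; offset = N ; scale⁻¹*scale = refl
  ; key-σ = λ (a , b) → ≡.trans (cong₂ (λ u v → u ℚ.- 0ℚ ℚ.* v) (coord-opposite a) (coord-opposite b))
      (solve 3 (λ x y N → (N :- x) :- con 0ℚ :* (N :- y) := (:- con 1ℚ) :* x :+ N) refl (coord a) (coord b) N) }
  where N = + ℕ.suc n ℚ./ 1
antitranspose-mapsLines {n} (just s) with s ≟ 0ℚ
... | yes refl = record
  { scale = ℚ.- 1ℚ ; scale⁻¹ = ℚ.- 1ℚ ; offset = N ; scale⁻¹*scale = refl
  ; key-σ = λ (a , b) → ≡.trans (coord-opposite b)
      (solve 3 (λ x y N → N :- y := (:- con 1ℚ) :* (y :- con 0ℚ :* x) :+ N) refl (coord a) (coord b) N) }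
  where N = + ℕ.suc n ℚ./ 1
... | no s≢0 = record
  { scale = r ; scale⁻¹ = s ; offset = N ℚ.- r ℚ.* N ; scale⁻¹*scale = ℚₚ.*-inverseʳ s ; key-σ = key-σ }
  where
  instance _ = ℚ.≢-nonZero s≢0
  r = ℚ.1/ s
  N = + ℕ.suc n ℚ./ 1
  key-σ : ∀ p → keyOf (just r) (antitranspose p) ≡ r ℚ.* keyOf (just s) p ℚ.+ (N ℚ.- r ℚ.* N)
  key-σ (a , b) = begin
    coord (opposite a) ℚ.- r ℚ.* coord (opposite b)
      ≡⟨ cong₂ (λ u v → u ℚ.- r ℚ.* v) (coord-opposite a) (coord-opposite b) ⟩
    (N ℚ.- coord a) ℚ.- r ℚ.* (N ℚ.- coord b)
      ≡⟨ solve 5 (λ x y r s N → (N :- x) :- r :* (N :- y) := (r :* (y :- s :* x) :+ (N :- r :* N)) :+ (r :* s :- con 1ℚ) :* x)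
               refl (coord a) (coord b) r s N ⟩
    (r ℚ.* (coord b ℚ.- s ℚ.* coord a) ℚ.+ (N ℚ.- r ℚ.* N)) ℚ.+ (r ℚ.* s ℚ.- 1ℚ) ℚ.* coord a
      ≡⟨ x+[e-1]y≡x _ _ (ℚₚ.*-inverseˡ s) ⟩
    r ℚ.* (coord b ℚ.- s ℚ.* coord a) ℚ.+ (N ℚ.- r ℚ.* N)
      ∎
    where open ≡-Reasoning

module ListSum {a ℓ} (G : AbelianGroup a ℓ) where
  open AbelianGroup G renaming (refl to ≈-refl; sym to ≈-sym; trans to ≈-trans)
  open import Algebra.Properties.AbelianGroup G using (ε⁻¹≈ε; ⁻¹-∙-comm)
  open import Algebra.Properties.CommutativeMonoid.Sum commutativeMonoid using (sum-syntax)
  open import Algebra.Properties.CommutativeSemigroup commutativeSemigroup using (interchange)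

  ∑ᴸ : {A : Set} → (A → Carrier) → List A → Carrier
  ∑ᴸ f xs = foldr _∙_ ε (map f xs)

  ∑ᴸ-distrib-∙ : {A : Set} (f g : A → Carrier) → ∀ xs → ∑ᴸ (λ x → f x ∙ g x) xs ≈ ∑ᴸ f xs ∙ ∑ᴸ g xs
  ∑ᴸ-distrib-∙ f g []       = ≈-sym (identityʳ ε)
  ∑ᴸ-distrib-∙ f g (x ∷ xs) = ≈-trans (∙-congˡ (∑ᴸ-distrib-∙ f g xs)) (interchange _ _ _ _)

  ∑ᴸ-⁻¹ : {A : Set} (f : A → Carrier) → ∀ xs → ∑ᴸ (λ x → f x ⁻¹) xs ≈ ∑ᴸ f xs ⁻¹
  ∑ᴸ-⁻¹ f []       = ≈-sym ε⁻¹≈ε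
  ∑ᴸ-⁻¹ f (x ∷ xs) = ≈-trans (∙-congˡ (∑ᴸ-⁻¹ f xs)) (⁻¹-∙-comm (f x) (∑ᴸ f xs))

  ∑ᴸ-++ : {A : Set} (f : A → Carrier) → ∀ xs ys → ∑ᴸ f (xs ++ ys) ≈ ∑ᴸ f xs ∙ ∑ᴸ f ys
  ∑ᴸ-++ f []       ys = ≈-sym (identityˡ _)
  ∑ᴸ-++ f (x ∷ xs) ys = ≈-trans (∙-congˡ (∑ᴸ-++ f xs ys)) (≈-sym (assoc _ _ _))

  ∑ᴸ-concatMap : {A B : Set} (f : B → Carrier) (g : A → List B) → ∀ xs →
                 ∑ᴸ f (concatMap g xs) ≈ ∑ᴸ (λ x → ∑ᴸ f (g x)) xs
  ∑ᴸ-concatMap f g []       = ≈-refl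
  ∑ᴸ-concatMap f g (x ∷ xs) = ≈-trans (∑ᴸ-++ f (g x) _) (∙-congˡ (∑ᴸ-concatMap f g xs))

  ∑ᴸ-filter : {A : Set} {P : A → Set} (f : A → Carrier) (P? : ∀ x → Dec (P x)) → ∀ xs →
              ∑ᴸ f (filter P? xs) ≈ ∑ᴸ (λ x → if does (P? x) then f x else ε) xs
  ∑ᴸ-filter f P? [] = ≈-refl
  ∑ᴸ-filter f P? (x ∷ xs) with does (P? x)
  ... | true  = ∙-congˡ (∑ᴸ-filter f P? xs)
  ... | false = ≈-trans (∑ᴸ-filter f P? xs) (≈-sym (identityˡ _))

  ∑ᴸ-map : {A B : Set} (f : B → Carrier) (g : A → B) → ∀ xs → ∑ᴸ f (map g xs) ≡ ∑ᴸ (f ∘ g) xs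
  ∑ᴸ-map f g xs = cong (foldr _∙_ ε) (≡.sym (map-∘ xs))

  ∑ᴸ-tabulate : ∀ {m} {A : Set} (f : A → Carrier) (g : Fin m → A) → ∑ᴸ f (tabulate g) ≡ ∑[ i < m ] f (g i)
  ∑ᴸ-tabulate {ℕ.zero}  f g = refl
  ∑ᴸ-tabulate {ℕ.suc m} f g = cong (λ s → f (g zero) ∙ s) (∑ᴸ-tabulate f (g ∘ suc))

module _ {c ℓ} (F : Field c ℓ) where
  open Field F hiding (zero; refl; sym) renaming (trans to ≈-trans)
  open import Algebra.Properties.CommutativeMonoid.Sum +-commutativeMonoid
    using (sum-syntax; sum-cong-≋; sum-cong-≗; ∑-comm; ∑-permute)
  open import Algebra.Properties.AbelianGroup +-abelianGroup using (identityʳ-unique; x∙y⁻¹≈ε⇒x≈y)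
  open import Relation.Binary.Reasoning.Setoid setoid
  open ListSum +-abelianGroup

  gridSum : ∀ {n} → (Point n → Carrier) → Carrier
  gridSum {n} h = ∑[ a < n ] ∑[ b < n ] h (a , b)

  ∑ᴸ-points : ∀ {n} (h : Point n → Carrier) → ∑ᴸ h (points n) ≈ gridSum h
  ∑ᴸ-points {n} h = begin
    ∑ᴸ h (points n)                                       ≈⟨ ∑ᴸ-concatMap h (λ a → map (a ,_) (allFin n)) (allFin n) ⟩
    ∑ᴸ (λ a → ∑ᴸ h (map (a ,_) (allFin n))) (allFin n)    ≡⟨ ∑ᴸ-tabulate (λ a → ∑ᴸ h (map (a ,_) (allFin n))) (λ a → a) ⟩
    ∑[ a < n ] ∑ᴸ h (map (a ,_) (allFin n))               ≡⟨ sum-cong-≗ (λ a → ∑ᴸ-map h (a ,_) (allFin n)) ⟩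
    ∑[ a < n ] ∑ᴸ (λ b → h (a , b)) (allFin n)            ≡⟨ sum-cong-≗ (λ a → ∑ᴸ-tabulate (λ b → h (a , b)) (λ b → b)) ⟩
    gridSum h                                             ∎

  gridSum-transpose : ∀ {n} (h : Point n → Carrier) → gridSum (h ∘ transpose) ≈ gridSum h
  gridSum-transpose h = ∑-comm (λ a b → h (b , a))

  gridSum-antitranspose : ∀ {n} (h : Point n → Carrier) → gridSum (h ∘ antitranspose) ≈ gridSum h
  gridSum-antitranspose {n} h = begin
    ∑[ a < n ] ∑[ b < n ] h (opposite b , opposite a)  ≈⟨ ∑-comm (λ a b → h (opposite b , opposite a)) ⟩
    ∑[ b < n ] ∑[ a < n ] h (opposite b , opposite a)  ≈⟨ ∑-permute (λ b → ∑[ a < n ] h (b , opposite a)) Perm.reverse ⟨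
    ∑[ b < n ] ∑[ a < n ] h (b , opposite a)           ≈⟨ sum-cong-≋ (λ b → ∑-permute (λ a → h (b , a)) Perm.reverse) ⟨
    gridSum h                                          ∎

  module _ {n : ℕ} where

    linePoints : Slope → ℚ → List (Point n)
    linePoints t k = filter (λ p → keyOf t p ≟ k) (points n)

    onLine : Slope → ℚ → Assignment F {n} → Point n → Carrier
    onLine t k X p = if does (keyOf t p ≟ k) then uncurry X p else 0#

    cluePoly≈gridSum : ∀ t k X → cluePoly F t k X ≈ gridSum (onLine t k X)
    cluePoly≈gridSum t k X = ≈-trans (∑ᴸ-filter (uncurry X) (λ p → keyOf t p ≟ k) (points n))
                                      (∑ᴸ-points (onLine t k X))

    cluePoly-+ : ∀ t k (X Y : Assignment F {n}) →
                 cluePoly F t k (λ a b → X a b + Y a b) ≈ cluePoly F t k X + cluePoly F t k Y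
    cluePoly-+ t k X Y = ∑ᴸ-distrib-∙ (uncurry X) (uncurry Y) (linePoints t k)

    cluePoly-neg : ∀ t k (X : Assignment F {n}) → cluePoly F t k (λ a b → - X a b) ≈ - cluePoly F t k X
    cluePoly-neg t k X = ∑ᴸ-⁻¹ (uncurry X) (linePoints t k)

    module _ (M : RKPuzzle F n) where
      open RKPuzzle M

      IsHomogeneousSolution : Assignment F {n} → Set ℓ
      IsHomogeneousSolution Z = ∀ t → t ∈ slopes → ∀ (a b : Fin n) → cluePoly F t (key t a b) Z ≈ 0#

      solution-difference : ∀ {X Y} → IsSolution F M X → IsSolution F M Y →
                            IsHomogeneousSolution (λ a b → X a b - Y a b)
      solution-difference {X} {Y} sX sY t t∈ a b = begin
        cluePoly F t k (λ a b → X a b - Y a b)               ≈⟨ cluePoly-+ t k X (λ a b → - Y a b) ⟩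
        cluePoly F t k X + cluePoly F t k (λ a b → - Y a b)  ≈⟨ +-congˡ (cluePoly-neg t k Y) ⟩
        cluePoly F t k X - cluePoly F t k Y                  ≈⟨ +-cong (sX t t∈ a b) (-‿cong (sY t t∈ a b)) ⟩
        clue t k - clue t k                                  ≈⟨ -‿inverseʳ _ ⟩
        0#                                                   ∎
        where k = key t a b

      solution-+-homogeneous : ∀ {X Z} → IsSolution F M X → IsHomogeneousSolution Z →
                               IsSolution F M (λ a b → X a b + Z a b)
      solution-+-homogeneous {X} {Z} sX hZ t t∈ a b = begin
        cluePoly F t k (λ a b → X a b + Z a b)  ≈⟨ cluePoly-+ t k X Z ⟩
        cluePoly F t k X + cluePoly F t k Z     ≈⟨ +-cong (sX t t∈ a b) (hZ t t∈ a b) ⟩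
        clue t k + 0#                           ≈⟨ +-identityʳ _ ⟩
        clue t k                                ∎
        where k = key t a b

      homogeneous-vanishes : ∀ {i j X Z} → UniquelySolvable F M i j → IsSolution F M X →
                             IsHomogeneousSolution Z → Z i j ≈ 0#
      homogeneous-vanishes {i} {j} {X} {Z} unique sX hZ =
        identityʳ-unique (X i j) (Z i j) (unique _ X (solution-+-homogeneous sX hZ) sX)

      uniquelySolvable-if-homogeneous-vanish : ∀ {i j} → (∀ Z → IsHomogeneousSolution Z → Z i j ≈ 0#) →
                                               UniquelySolvable F M i j
      uniquelySolvable-if-homogeneous-vanish {i} {j} vanish X Y sX sY =
        x∙y⁻¹≈ε⇒x≈y (X i j) (Y i j) (vanish _ (solution-difference sX sY))

  record GridSymmetry (n : ℕ) : Set (c ⊔ ℓ) where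
    field
      act         : Point n → Point n
      gridSum-act : ∀ h → gridSum (h ∘ act) ≈ gridSum h
      mapsLines   : ∀ t → MapsLines act t (inv t)

    pullback : Assignment F {n} → Assignment F {n}
    pullback Z a b = uncurry Z (act (a , b))

    cluePoly-pullback : ∀ t p Z →
      cluePoly F t (keyOf t p) (pullback Z) ≈ cluePoly F (inv t) (keyOf (inv t) (act p)) Z
    cluePoly-pullback t p Z = begin
      cluePoly F t (keyOf t p) (pullback Z)          ≈⟨ cluePoly≈gridSum t _ (pullback Z) ⟩
      gridSum (onLine t (keyOf t p) (pullback Z))    ≡⟨ sum-cong-≗ (λ a → sum-cong-≗ (λ b → same-line-on (a , b))) ⟩
      gridSum (onLine t′ k′ Z ∘ act)                 ≈⟨ gridSum-act (onLine t′ k′ Z) ⟩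
      gridSum (onLine t′ k′ Z)                       ≈⟨ cluePoly≈gridSum t′ k′ Z ⟨
      cluePoly F t′ k′ Z                             ∎
      where
      t′ = inv t
      k′ = keyOf t′ (act p)
      same-line-on : ∀ q → onLine t (keyOf t p) (pullback Z) q ≡ onLine t′ k′ Z (act q)
      same-line-on q = cong (λ on → if on then uncurry (pullback Z) q else 0#)
                            (MapsLines.same-line (mapsLines t) q p)

    module _ (M : RKPuzzle F n) (closed : ∀ t → t ∈ RKPuzzle.slopes M → inv t ∈ RKPuzzle.slopes M) where

      pullback-homogeneous : ∀ {Z} → IsHomogeneousSolution M Z → IsHomogeneousSolution M (pullback Z)
      pullback-homogeneous {Z} hZ t t∈ a b =
        ≈-trans (cluePoly-pullback t (a , b) Z) (uncurry (hZ (inv t) (closed t t∈)) (act (a , b)))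

      uniquelySolvable-act : Solvable F M → ∀ {i j} → UniquelySolvable F M i j →
                             uncurry (UniquelySolvable F M) (act (i , j))
      uniquelySolvable-act (X , sX) unique = uniquelySolvable-if-homogeneous-vanish M
        (λ Z hZ → homogeneous-vanishes M unique sX (pullback-homogeneous hZ))

  transposeSymmetry : ∀ {n} → GridSymmetry n
  transposeSymmetry = record
    { act = transpose ; gridSum-act = gridSum-transpose ; mapsLines = transpose-mapsLines }

  antitransposeSymmetry : ∀ {n} → GridSymmetry n
  antitransposeSymmetry = record
    { act = antitranspose ; gridSum-act = gridSum-antitranspose ; mapsLines = antitranspose-mapsLines }

-- 1 ≤ n is not needed: an entry (i , j) already makes the grid nonempty.
proposition3 : ∀ {c ℓ : Level} (F : Field c ℓ) (n : ℕ) → 1 ≤ n →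
    (M : RKPuzzle F n) →
    (∀ t → t ∈ RKPuzzle.slopes M → inv t ∈ RKPuzzle.slopes M) →
    Solvable F M →
    ∀ (i j : Fin n) → UniquelySolvable F M i j →
    UniquelySolvable F M j i × UniquelySolvable F M (opposite j) (opposite i)
proposition3 F n _ M closed solvable i j unique =
  uniquelySolvable-act (transposeSymmetry F) M closed solvable unique ,
  uniquelySolvable-act (antitransposeSymmetry F) M closed solvable unique
  where open GridSymmetry
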